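{- Let $G$ be a graph that is weakly-cliqued and connected, with $\chi(G)\ge 3$. Then $G$ is trivially power-colorable.
   Context: Graphs are undirected and simple; $\chi(G)$ is the chromatic number. For a number $k$, a $k$-coloring of a graph is a proper coloring $V\to k=\{0,\dots,k-1\}$. For graphs $(G_i)_{i\in I}$, the (direct/tensor) product $\times_{i\in I}G_i$ has vertex set $\times_{i\in I}V(G_i)$, and $u=(u_i)$, $v=(v_i)$ are adjacent iff $u_iv_i\in E(G_i)$ for every $i\in I$; $G^n$ denotes the product of $n$ copies of $G$. A coloring $\Phi$ of $\times_{i\in I}G_i$ is trivial if there exist $i^*\in I$ and a coloring $\phi$ of $G_{i^*}$ with $\Phi(v)=\phi(v_{i^*})$ for all vertices $v$. A graph $H$ is trivially power-colorable if for every positive integer $n$, every $\chi(H^n)$-coloring of $H^n$ is trivial. A graph $G$ with $\chi(G)=k$ is weakly-cliqued if every vertex of $G$ lies in a clique of size $k$. -}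

module Defs where

open import Data.Nat using (ℕ; suc; _<_; _≤_)
open import Data.Fin using (Fin; zero)
open import Data.Product using (Σ; ∃; _×_; _,_)
open import Relation.Nullary using (¬_)
open import Relation.Binary.PropositionalEquality using (_≡_; _≢_)
open import Function.Bundles using (_↔_)

record Graph : Set₁ where
  field
    V      : Set
    Adj    : V → V → Set
    sym    : ∀ {u v} → Adj u v → Adj v u
    irrefl : ∀ {v} → ¬ Adj v v
open Graph public

Finite : Graph → Set
Finite G = Σ ℕ λ m → V G ↔ Fin m

IsColoring : (G : Graph) (k : ℕ) → (V G → Fin k) → Set
IsColoring G k c = ∀ {u v} → Adj G u v → c u ≢ c v

Colorable : Graph → ℕ → Set
Colorable G k = Σ (V G → Fin k) (IsColoring G k)

IsChromaticNumber : Graph → ℕ → Set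
IsChromaticNumber G k = Colorable G k × (∀ j → j < k → ¬ Colorable G j)

data Walk (G : Graph) : V G → V G → Set where
  here : ∀ {v} → Walk G v v
  step : ∀ {u w v} → Adj G u w → Walk G w v → Walk G u v

Connected : Graph → Set
Connected G = ∀ u v → Walk G u v

WeaklyCliqued : Graph → Set
WeaklyCliqued G =
  Σ ℕ λ k → IsChromaticNumber G k ×
    (∀ v → Σ (Fin k → V G) λ f →
       (∀ i j → i ≢ j → Adj G (f i) (f j)) × ∃ λ i → f i ≡ v)

-- Direct (tensor) power G^(suc m) (the power with n = suc m ≥ 1 factors):
-- vertices Fin (suc m) → V G, adjacent iff adjacent in every coordinate.
Power : Graph → ℕ → Graph
Power G m = record
  { V      = Fin (suc m) → V G
  ; Adj    = λ u v → ∀ i → Adj G (u i) (v i)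
  ; sym    = λ a i → sym G (a i)
  ; irrefl = λ a → irrefl G (a zero)
  }

IsTrivialPowerColoring : (G : Graph) (m k : ℕ) → (V (Power G m) → Fin k) → Set
IsTrivialPowerColoring G m k c =
  Σ (Fin (suc m)) λ i → Σ (V G → Fin k) λ φ →
    IsColoring G k φ × (∀ v → c v ≡ φ (v i))

TriviallyPowerColorable : Graph → Set
TriviallyPowerColorable G =
  ∀ (m k : ℕ) → IsChromaticNumber (Power G m) k →
    ∀ (c : V (Power G m) → Fin k) → IsColoring (Power G m) k c →
      IsTrivialPowerColoring G m k c

{-# OPTIONS --safe #-}
-- With k = χ(G) ≥ 3, every k-coloring of the power of K_k depends on a single coordinate
-- (Greenwell–Lovász): two vertices that differ only at coordinate j and are colored differently
-- force, through k-cliques containing adjacent vertices, the color of every vertex to be determined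
-- by its j-th entry. In the power of G every vertex lies in a box, the product of the k-cliques
-- through its coordinates, which is a copy of the power of K_k; so on each box the coloring depends
-- on one coordinate. Boxes whose base points differ along an edge of G in one coordinate are joined
-- by enough edges to force the same coordinate and the same colors, and connectivity of G spreads
-- this over all boxes, hence over the whole power.
module Submission where

open import Defs hiding (sym)
open import Data.Nat using (ℕ; zero; suc; _+_; _≤_; z≤n; s≤s)
open import Data.Nat.Properties using (≤-antisym; ≤-trans; ≮⇒≥; 1+n≰n)
open import Data.Fin using (Fin; zero; suc; punchIn; punchOut)
open import Data.Fin.Properties
  using (_≟_; any?; ¬Fin0; 0≢1+n; punchInᵢ≢i; punchOut-injective; injective⇒≤)
import Data.Fin.Permutation.Components as Perm
open import Data.Vec.Functional using (Vector; updateAt)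
open import Data.Vec.Functional.Properties
  using (updateAt-updates; updateAt-minimal; updateAt-id-local; updateAt-updateAt)
open import Data.List using (List; []; _∷_; allFin)
open import Data.List.Relation.Unary.Any using (here; there)
open import Data.List.Membership.Propositional using (_∈_)
open import Data.List.Membership.Propositional.Properties using (∈-allFin)
open import Data.Product using (Σ; ∃; _×_; _,_; proj₁; proj₂)
open import Data.Sum using (_⊎_; inj₁; inj₂; fromInj₁)
open import Data.Empty using (⊥; ⊥-elim)
open import Function using (_∘_; const)
open import Function.Bundles using (Inverse)
open import Function.Definitions using (Injective)
open import Relation.Nullary using (¬_; Dec; yes; no)
open import Relation.Nullary.Decidable using (dec-true; dec-false)
open import Relation.Binary.PropositionalEquality
  using (_≡_; _≢_; _≗_; refl; sym; trans; cong; subst; subst₂; module ≡-Reasoning)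

injective⇒surjective : ∀ {n} (f : Fin n → Fin n) → Injective _≡_ _≡_ f → ∀ a → ∃ λ s → f s ≡ a
injective⇒surjective {suc n} f f-inj a with any? (λ s → f s ≟ a)
... | yes hit = hit
... | no miss = ⊥-elim (1+n≰n (injective⇒≤ g-inj))
  where
  a≢f : ∀ s → a ≢ f s
  a≢f s a≡fs = miss (s , sym a≡fs)
  g : Fin (suc n) → Fin n
  g s = punchOut (a≢f s)
  g-inj : Injective _≡_ _≡_ g
  g-inj {x} {y} e = f-inj (punchOut-injective (a≢f x) (a≢f y) e)

cases-at : ∀ {n} (j : Fin n) (P : Fin n → Set) → P j → (∀ i → i ≢ j → P i) → ∀ i → P i
cases-at j P at-j away i with i ≟ j
... | yes refl = at-j
... | no i≢j = away i i≢j

third : ∀ {n} → Fin (3 + n) → Fin (3 + n) → Fin (3 + n)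
third zero          zero          = suc zero
third zero          (suc zero)    = suc (suc zero)
third zero          (suc (suc _)) = suc zero
third (suc zero)    zero          = suc (suc zero)
third (suc zero)    (suc _)       = zero
third (suc (suc _)) zero          = suc zero
third (suc (suc _)) (suc _)       = zero

third-≢ : ∀ {n} (a b : Fin (3 + n)) → third a b ≢ a × third a b ≢ b
third-≢ zero          zero          = (λ ()) , (λ ())
third-≢ zero          (suc zero)    = (λ ()) , (λ ())
third-≢ zero          (suc (suc _)) = (λ ()) , (λ ())
third-≢ (suc zero)    zero          = (λ ()) , (λ ())
third-≢ (suc zero)    (suc _)       = (λ ()) , (λ ())
third-≢ (suc (suc _)) zero          = (λ ()) , (λ ())
third-≢ (suc (suc _)) (suc _)       = (λ ()) , (λ ())

transpose-injective : ∀ {n} (a b : Fin n) → Injective _≡_ _≡_ (Perm.transpose a b)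
transpose-injective a b {x} {y} e =
  trans (sym (Perm.transpose-inverse b a))
        (trans (cong (Perm.transpose b a) e) (Perm.transpose-inverse b a))

transpose-hits : ∀ {n} (a b : Fin n) → Perm.transpose a b a ≡ b
transpose-hits a b rewrite dec-true (a ≟ a) refl = refl

transpose-fixes : ∀ {n} (a b x : Fin n) → x ≢ a → x ≢ b → Perm.transpose a b x ≡ x
transpose-fixes a b x x≢a x≢b rewrite dec-false (x ≟ a) x≢a | dec-false (x ≟ b) x≢b = refl

startingWith : ∀ {n} → Fin (2 + n) → Fin (2 + n) → Fin (2 + n) → Fin (2 + n)
startingWith a b = Perm.transpose zero a ∘ Perm.transpose (suc zero) (Perm.transpose a zero b)

startingWith-injective : ∀ {n} (a b : Fin (2 + n)) → Injective _≡_ _≡_ (startingWith a b)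
startingWith-injective a b =
  transpose-injective (suc zero) (Perm.transpose a zero b) ∘ transpose-injective zero a

startingWith-one : ∀ {n} (a b : Fin (2 + n)) → startingWith a b (suc zero) ≡ b
startingWith-one a b =
  trans (cong (Perm.transpose zero a) (transpose-hits (suc zero) (Perm.transpose a zero b)))
        (Perm.transpose-inverse zero a)

startingWith-zero : ∀ {n} (a b : Fin (2 + n)) → a ≢ b → startingWith a b zero ≡ a
startingWith-zero a b a≢b =
  trans (cong (Perm.transpose zero a) (transpose-fixes (suc zero) _ zero (λ ()) 0≢b′))
        (transpose-hits zero a)
  where
  0≢b′ : zero ≢ Perm.transpose a zero b
  0≢b′ e = a≢b (sym (transpose-injective a zero (trans (sym e) (sym (transpose-hits a zero)))))

_[_]≔_ : ∀ {A : Set} {n} → Vector A n → Fin n → A → Vector A n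
p [ j ]≔ x = updateAt p j (const x)

[]≔-updates : ∀ {A : Set} {n} (p : Vector A n) j (x : A) → (p [ j ]≔ x) j ≡ x
[]≔-updates p j x = updateAt-updates j p

[]≔-minimal : ∀ {A : Set} {n} (p : Vector A n) {i j} (x : A) → i ≢ j → (p [ j ]≔ x) i ≡ p i
[]≔-minimal p {i} {j} x = updateAt-minimal i j p

SameExcept : ∀ {A : Set} {n} → Fin n → Vector A n → Vector A n → Set
SameExcept j x y = ∀ i → i ≢ j → x i ≡ y i

[]≔-sameExcept : ∀ {A : Set} {n} (p : Vector A n) j (x : A) → SameExcept j p (p [ j ]≔ x)
[]≔-sameExcept p j x i i≢j = sym ([]≔-minimal p x i≢j)

DependsOnly : ∀ {A B : Set} {n} → Fin n → (Vector A n → B) → Set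
DependsOnly j f = ∀ v w → v j ≡ w j → f v ≡ f w

module _ {A : Set} {n} (R : Vector A n → Set) (R-resp : ∀ {p q} → p ≗ q → R p → R q) where

  update-all : ∀ {p} q → R p → (∀ j r → R r → R (r [ j ]≔ q j)) → R q
  update-all {p} q Rp update = R-resp (λ l → updates-∈ (∈-allFin l)) (R-updates (allFin n))
    where
    updates : List (Fin n) → Vector A n
    updates []      = p
    updates (j ∷ L) = updates L [ j ]≔ q j

    R-updates : ∀ L → R (updates L)
    R-updates []      = Rp
    R-updates (j ∷ L) = update j (updates L) (R-updates L)

    updates-∈ : ∀ {l L} → l ∈ L → updates L l ≡ q l
    updates-∈ {l} (here refl) = []≔-updates _ l (q l)
    updates-∈ {l} {j ∷ L} (there l∈L) with l ≟ j
    ... | yes refl = []≔-updates _ l (q l)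
    ... | no l≢j = trans ([]≔-minimal _ (q j) l≢j) (updates-∈ l∈L)

module _ {G : Graph} {n} (R : Vector (V G) n → Set) (R-resp : ∀ {p q} → p ≗ q → R p → R q)
  (j : Fin n) (move : ∀ p x → Adj G (p j) x → R p → R (p [ j ]≔ x)) where

  walk-coordinate : ∀ {u y} → Walk G u y → ∀ p → p j ≡ u → R p → R (p [ j ]≔ y)
  walk-coordinate here p pj≡u Rp = R-resp (λ l → sym (updateAt-id-local j p (sym pj≡u) l)) Rp
  walk-coordinate (step {w = w} e rest) p pj≡u Rp =
    R-resp (updateAt-updateAt j p)
      (walk-coordinate rest (p [ j ]≔ w) ([]≔-updates p j w)
        (move p w (subst (λ a → Adj G a w) (sym pj≡u) e) Rp))

  connected-coordinate : Connected G → ∀ p y → R p → R (p [ j ]≔ y)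
  connected-coordinate connected p y = walk-coordinate (connected (p j) y) p refl

Complete : ℕ → Graph
Complete k = record
  { V = Fin k ; Adj = _≢_ ; sym = λ a≢b b≡a → a≢b (sym b≡a) ; irrefl = λ a≢a → a≢a refl }

record CliqueCover (G : Graph) (k : ℕ) : Set where
  field
    clique          : V G → Fin k → V G
    clique-adj      : ∀ v {a b} → a ≢ b → Adj G (clique v a) (clique v b)
    position        : V G → Fin k
    clique-position : ∀ v → clique v (position v) ≡ v

complete-cover : ∀ {k} → CliqueCover (Complete k) k
complete-cover = record
  { clique          = λ v a → a
  ; clique-adj      = λ _ a≢b → a≢b
  ; position        = λ v → v
  ; clique-position = λ _ → refl
  }

module Coloring (H : Graph) {k} (c : V H → Fin k) (proper : IsColoring H k c) where

  IsClique : (Fin k → V H) → Set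
  IsClique K = ∀ {s t} → s ≢ t → Adj H (K s) (K t)

  clique-rainbow : ∀ {K} → IsClique K → ∀ a → ∃ λ s → c (K s) ≡ a
  clique-rainbow {K} K-clique = injective⇒surjective (c ∘ K) c∘K-injective
    where
    c∘K-injective : Injective _≡_ _≡_ (c ∘ K)
    c∘K-injective {s} {t} e with s ≟ t
    ... | yes s≡t = s≡t
    ... | no s≢t = ⊥-elim (proper (K-clique s≢t) e)

  -- Every other color already occurs on the clique.
  clique-color-forced : ∀ {K} → IsClique K → ∀ t₀ v →
    (∀ t → t ≢ t₀ → Adj H v (K t)) → c v ≡ c (K t₀)
  clique-color-forced K-clique t₀ v v~K with clique-rainbow K-clique (c v)
  ... | s , cKs≡cv with s ≟ t₀
  ... | yes refl = sym cKs≡cv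
  ... | no s≢t₀ = ⊥-elim (proper (v~K s s≢t₀) (sym cKs≡cv))

module _ {G : Graph} {k} (cover : CliqueCover G (suc k)) {m} (c : V (Power G m) → Fin (suc k))
  (proper : IsColoring (Power G m) (suc k) c) where
  open CliqueCover cover
  open Coloring (Power G m) c proper

  -- Vertices of a power are functions, so pointwise equal vertices are not known to be equal;
  -- both are adjacent to all but one vertex of a clique through v, hence share its color.
  coloring-≗ : ∀ {v w} → v ≗ w → c v ≡ c w
  coloring-≗ {v} {w} v≗w = trans (forced v (λ _ → refl)) (sym (forced w v≗w))
    where
    K : Fin (suc k) → V (Power G m)
    K t l = clique (v l) (Perm.transpose zero (position (v l)) t)

    K-clique : IsClique K
    K-clique s≢t l = clique-adj (v l) (s≢t ∘ transpose-injective zero (position (v l)))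

    K-zero : ∀ l → K zero l ≡ v l
    K-zero l = trans (cong (clique (v l)) (transpose-hits zero (position (v l)))) (clique-position (v l))

    forced : ∀ u → v ≗ u → c u ≡ c (K zero)
    forced u v≗u = clique-color-forced K-clique zero u
      (λ t t≢0 l → subst (λ x → Adj G x (K t l)) (trans (K-zero l) (v≗u l))
                           (K-clique (t≢0 ∘ sym) l))

module GreenwellLovász {k' m : ℕ} (d : Vector (Fin (3 + k')) (suc m) → Fin (3 + k'))
  (proper : IsColoring (Power (Complete (3 + k')) m) (3 + k') d) where
  open Coloring (Power (Complete (3 + k')) m) d proper

  Point : Set
  Point = Vector (Fin (3 + k')) (suc m)

  d-≗ : ∀ {v w} → v ≗ w → d v ≡ d w
  d-≗ = coloring-≗ complete-cover d proper

  Separates : Fin (suc m) → Point → Point → Set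
  Separates j x y = SameExcept j x y × d x ≢ d y

  separates-≢ : ∀ {j x y} → Separates j x y → x j ≢ y j
  separates-≢ {j} {x} {y} (same , dx≢dy) xj≡yj =
    dx≢dy (d-≗ (cases-at j (λ i → x i ≡ y i) xj≡yj same))

  pairClique : Point → Point → Fin (3 + k') → Point
  pairClique x z t i = startingWith (x i) (z i) t

  pairClique-clique : ∀ x z → IsClique (pairClique x z)
  pairClique-clique x z s≢t i = s≢t ∘ startingWith-injective (x i) (z i)

  pairClique-zero : ∀ {x z} → (∀ i → x i ≢ z i) → pairClique x z zero ≗ x
  pairClique-zero {x} {z} x~z i = startingWith-zero (x i) (z i) (x~z i)

  pairClique-one : ∀ x z → pairClique x z (suc zero) ≗ z
  pairClique-one x z i = startingWith-one (x i) (z i)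

  -- On a clique through the adjacent x and z, y cannot have the color of x, nor of the vertices
  -- beyond z, which are adjacent to y.
  separation-forces : ∀ {j x y z} → Separates j x y →
    z j ≡ y j → (∀ i → i ≢ j → z i ≢ x i) → d z ≡ d y
  separation-forces {j} {x} {y} {z} sep@(same , dx≢dy) zj≡yj z≢x =
    go (clique-rainbow (pairClique-clique x z) (d y))
    where
    x~z : ∀ i → x i ≢ z i
    x~z = cases-at j (λ i → x i ≢ z i) (λ xj≡zj → separates-≢ sep (trans xj≡zj zj≡yj))
                     (λ i i≢j → z≢x i i≢j ∘ sym)

    K₀ : pairClique x z zero ≗ x
    K₀ = pairClique-zero x~z

    K₁ : pairClique x z (suc zero) ≗ z
    K₁ = pairClique-one x z

    go : (∃ λ s → d (pairClique x z s) ≡ d y) → d z ≡ d y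
    go (zero , e)        = ⊥-elim (dx≢dy (trans (d-≗ (sym ∘ K₀)) e))
    go (suc zero , e)    = trans (d-≗ (sym ∘ K₁)) e
    go (suc (suc s) , e) = ⊥-elim (proper y~K (sym e))
      where
      y~K : ∀ i → y i ≢ pairClique x z (suc (suc s)) i
      y~K = cases-at j _
        (λ yj≡ → pairClique-clique x z {suc zero} {suc (suc s)} (λ ()) j
                   (trans (K₁ j) (trans zj≡yj yj≡)))
        (λ i i≢j yi≡ → pairClique-clique x z {zero} {suc (suc s)} (λ ()) i
                         (trans (K₀ i) (trans (same i i≢j) yi≡)))

  -- Using k ≥ 3, pick x′ ≡ x at j avoiding both x and w elsewhere: (x′, x′ [ j ]≔ y j) separates
  -- at j as well, and w avoids x′ off j.
  constant-on-fibre : ∀ {j x y} → Separates j x y → ∀ w → w j ≡ y j → d w ≡ d y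
  constant-on-fibre {j} {x} {y} sep w wj≡yj = trans (separation-forces sep′ wj≡y′j w≢x′) dy′≡dy
    where
    x′ y′ z : Point
    x′ = (λ i → third (w i) (x i)) [ j ]≔ x j
    y′ = x′ [ j ]≔ y j
    z  = (λ i → third (x′ i) (x i)) [ j ]≔ y j

    x′-away : ∀ i → i ≢ j → x′ i ≡ third (w i) (x i)
    x′-away i = []≔-minimal _ (x j)

    dy′≡dy : d y′ ≡ d y
    dy′≡dy = separation-forces sep ([]≔-updates x′ j (y j))
      (λ i i≢j → proj₂ (third-≢ (w i) (x i))
                   ∘ trans (sym (x′-away i i≢j)) ∘ trans (sym ([]≔-minimal x′ (y j) i≢j)))

    dz≡dy : d z ≡ d y
    dz≡dy = separation-forces sep ([]≔-updates _ j (y j))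
      (λ i i≢j → proj₂ (third-≢ (x′ i) (x i)) ∘ trans (sym ([]≔-minimal _ (y j) i≢j)))

    x′~z : ∀ i → x′ i ≢ z i
    x′~z = cases-at j (λ i → x′ i ≢ z i)
      (λ e → separates-≢ sep (trans (sym ([]≔-updates _ j (x j))) (trans e ([]≔-updates _ j (y j)))))
      (λ i i≢j e → proj₁ (third-≢ (x′ i) (x i)) (trans (sym ([]≔-minimal _ (y j) i≢j)) (sym e)))

    sep′ : Separates j x′ y′
    sep′ = []≔-sameExcept x′ j (y j) , λ e → proper x′~z (trans e (trans dy′≡dy (sym dz≡dy)))

    wj≡y′j : w j ≡ y′ j
    wj≡y′j = trans wj≡yj (sym ([]≔-updates x′ j (y j)))

    w≢x′ : ∀ i → i ≢ j → w i ≢ x′ i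
    w≢x′ i i≢j e = proj₁ (third-≢ (w i) (x i)) (trans (sym (x′-away i i≢j)) (sym e))

  separates-elsewhere : ∀ {j x y} → Separates j x y → ∀ a → a ≢ y j → Separates j y (y [ j ]≔ a)
  separates-elsewhere {j} {x} {y} sep a a≢yj =
    []≔-sameExcept y j a , λ e → proper y′~z (trans (sym e) (sym dz≡dy))
    where
    y′ z : Point
    y′ = y [ j ]≔ a
    z  = (λ i → punchIn (y′ i) zero) [ j ]≔ y j

    dz≡dy : d z ≡ d y
    dz≡dy = constant-on-fibre sep z ([]≔-updates _ j (y j))

    y′~z : ∀ i → y′ i ≢ z i
    y′~z = cases-at j (λ i → y′ i ≢ z i)
      (λ e → a≢yj (trans (sym ([]≔-updates y j a)) (trans e ([]≔-updates _ j (y j)))))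
      (λ i i≢j e → punchInᵢ≢i (y′ i) zero (trans (sym ([]≔-minimal _ (y j) i≢j)) (sym e)))

  separates⇒dependsOnly : ∀ {j x y} → Separates j x y → DependsOnly j d
  separates⇒dependsOnly {j} {x} {y} sep v w vj≡wj with v j ≟ y j
  ... | yes vj≡yj =
    trans (constant-on-fibre sep v vj≡yj) (sym (constant-on-fibre sep w (trans (sym vj≡wj) vj≡yj)))
  ... | no vj≢yj = trans (on-fibre v refl) (sym (on-fibre w vj≡wj))
    where
    on-fibre : ∀ u → v j ≡ u j → d u ≡ d (y [ j ]≔ v j)
    on-fibre u vj≡uj = constant-on-fibre (separates-elsewhere sep (v j) vj≢yj) u
      (trans (sym vj≡uj) (sym ([]≔-updates y j (v j))))

  -- Walking from the constant 0 vertex to its neighbour, the constant 1 vertex, one coordinate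
  -- at a time, some step must change the color.
  separation-exists : ∃ λ j → ∃ λ x → ∃ λ y → Separates j x y
  separation-exists =
    fromInj₁ (λ e → ⊥-elim (proper {const zero} {const (suc zero)} (λ _ ()) (sym e)))
      (update-all R R-resp (const (suc zero)) (inj₂ refl) update)
    where
    R : Point → Set
    R r = (∃ λ j → ∃ λ x → ∃ λ y → Separates j x y) ⊎ d r ≡ d (const zero)

    R-resp : ∀ {p q} → p ≗ q → R p → R q
    R-resp p≗q (inj₁ s) = inj₁ s
    R-resp p≗q (inj₂ e) = inj₂ (trans (sym (d-≗ p≗q)) e)

    update : ∀ j r → R r → R (r [ j ]≔ suc zero)
    update j r (inj₁ s) = inj₁ s
    update j r (inj₂ e) with d (r [ j ]≔ suc zero) ≟ d (const zero)
    ... | yes e′ = inj₂ e′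
    ... | no ne = inj₁ (j , r , _ , []≔-sameExcept r j (suc zero) , λ e′ → ne (trans (sym e′) e))

  depends-on-one-coordinate : ∃ λ j → DependsOnly j d
  depends-on-one-coordinate with separation-exists
  ... | j , x , y , sep = j , separates⇒dependsOnly sep

module Boxes {G : Graph} (connected : Connected G) {k' m : ℕ} (cover : CliqueCover G (3 + k'))
  (c : V (Power G m) → Fin (3 + k')) (proper : IsColoring (Power G m) (3 + k') c) where
  open CliqueCover cover
  open Coloring (Power G m) c proper

  Base : Set
  Base = Vector (V G) (suc m)

  Shape : Set
  Shape = Vector (Fin (3 + k')) (suc m)

  box : Base → Shape → V (Power G m)
  box p t l = clique (p l) (t l)

  c-≗ : ∀ {v w} → v ≗ w → c v ≡ c w
  c-≗ = coloring-≗ cover c proper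

  c-as-box : ∀ v → c v ≡ c (box v (position ∘ v))
  c-as-box v = c-≗ (λ l → sym (clique-position (v l)))

  BoxDependsOnly : Fin (suc m) → Base → Set
  BoxDependsOnly a p = DependsOnly a (c ∘ box p)

  boxDependsOnly-≗ : ∀ {a p p′} → p ≗ p′ → BoxDependsOnly a p → BoxDependsOnly a p′
  boxDependsOnly-≗ {a} {p} {p′} p≗p′ dep t t′ tₐ≡t′ₐ = begin
    c (box p′ t)  ≡⟨ c-≗ (λ l → cong (λ q → clique q (t l)) (sym (p≗p′ l))) ⟩
    c (box p t)   ≡⟨ dep t t′ tₐ≡t′ₐ ⟩
    c (box p t′)  ≡⟨ c-≗ (λ l → cong (λ q → clique q (t′ l)) (p≗p′ l)) ⟩
    c (box p′ t′) ∎
    where open ≡-Reasoning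

  box-depends-on-one-coordinate : ∀ p → ∃ λ a → BoxDependsOnly a p
  box-depends-on-one-coordinate p =
    GreenwellLovász.depends-on-one-coordinate (c ∘ box p)
      (λ t~t′ → proper (λ l → clique-adj (p l) (t~t′ l)))

  diagonal-rainbow : ∀ p α → ∃ λ u → c (box p (const u)) ≡ α
  diagonal-rainbow p = clique-rainbow (λ u≢u′ l → clique-adj (p l) u≢u′)

  []≔-edge : ∀ (q : Base) j {x} → Adj G (q j) x → Adj G (q j) ((q [ j ]≔ x) j)
  []≔-edge q j {x} = subst (Adj G (q j)) (sym ([]≔-updates q j x))

  module Step {j} {p p′ : Base} (same : SameExcept j p p′) (edge : Adj G (p j) (p′ j)) where

    -- Value x at coordinate b, background z elsewhere, and at j the position of q j itself,
    -- so that the boxes of p and p′ meet along the edge of G at coordinate j.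
    probe : Base → Fin (3 + k') → Fin (suc m) → Fin (3 + k') → Shape
    probe q z b x = (const z [ b ]≔ x) [ j ]≔ position (q j)

    box-probe-j : ∀ q z b x → box q (probe q z b x) j ≡ q j
    box-probe-j q z b x =
      trans (cong (clique (q j)) ([]≔-updates _ j (position (q j)))) (clique-position (q j))

    probe-b : ∀ {q z b x} → b ≢ j → probe q z b x b ≡ x
    probe-b {b = b} {x} b≢j = trans ([]≔-minimal _ _ b≢j) ([]≔-updates _ b x)

    probe-off-b : ∀ {q z a b x x′} → a ≢ b → probe q z b x a ≡ probe q z b x′ a
    probe-off-b {q} {a = a} a≢b with a ≟ j
    ... | yes refl = trans ([]≔-updates _ a _) (sym ([]≔-updates _ a _))
    ... | no a≢j = trans (trans ([]≔-minimal _ _ a≢j) ([]≔-minimal _ _ a≢b))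
                         (sym (trans ([]≔-minimal _ _ a≢j) ([]≔-minimal _ _ a≢b)))

    probe-differ : ∀ {q q′ b x y l} → l ≢ j → x ≢ y → probe q zero b x l ≢ probe q′ (suc zero) b y l
    probe-differ {b = b} {x} {y} {l} l≢j x≢y e = background-differ (l ≟ b)
      where
      e′ : (const zero [ b ]≔ x) l ≡ (const (suc zero) [ b ]≔ y) l
      e′ = trans (sym ([]≔-minimal _ _ l≢j)) (trans e ([]≔-minimal _ _ l≢j))

      background-differ : Dec (l ≡ b) → ⊥
      background-differ (yes refl) = x≢y (trans (sym ([]≔-updates _ l x)) (trans e′ ([]≔-updates _ l y)))
      background-differ (no l≢b) = 0≢1+n (trans (sym ([]≔-minimal _ _ l≢b)) (trans e′ ([]≔-minimal _ _ l≢b)))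

    crossing-edge : ∀ {b x y} → b ≢ j → x ≢ y →
      Adj (Power G m) (box p (probe p zero b x)) (box p′ (probe p′ (suc zero) b y))
    crossing-edge {b} {x} {y} b≢j x≢y = cases-at j adjacent-at
      (subst₂ (Adj G) (sym (box-probe-j p zero b x)) (sym (box-probe-j p′ (suc zero) b y)) edge)
      (λ l l≢j → subst (λ q → Adj G (clique (p l) (t l)) (clique q (t′ l))) (same l l≢j)
                   (clique-adj (p l) (probe-differ {p} {p′} {b} l≢j x≢y)))
      where
      t t′ : Shape
      t  = probe p zero b x
      t′ = probe p′ (suc zero) b y
      adjacent-at : Fin (suc m) → Set
      adjacent-at l = Adj G (box p t l) (box p′ t′ l)

    same-coordinate : ∀ {a b} → BoxDependsOnly a p → BoxDependsOnly b p′ → b ≢ j → b ≡ a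
    same-coordinate {a} {b} dep dep′ b≢j with b ≟ a
    ... | yes b≡a = b≡a
    ... | no b≢a with diagonal-rainbow p′ (c (box p (probe p zero b zero)))
    ... | u , eu = ⊥-elim (proper (crossing-edge b≢j (punchInᵢ≢i u zero)) (begin
      c (box p (probe p zero b (punchIn u zero))) ≡⟨ dep _ _ (probe-off-b {p} (b≢a ∘ sym)) ⟩
      c (box p (probe p zero b zero))             ≡⟨ sym eu ⟩
      c (box p′ (const u))                        ≡⟨ dep′ _ (probe p′ (suc zero) b u)
                                                       (sym (probe-b {p′} {suc zero} b≢j)) ⟩
      c (box p′ (probe p′ (suc zero) b u))        ∎))
      where open ≡-Reasoning

    colors-agree : ∀ {a} → BoxDependsOnly a p → BoxDependsOnly a p′ → a ≢ j →
      ∀ t t′ → t a ≡ t′ a → c (box p t) ≡ c (box p′ t′)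
    colors-agree {a} dep dep′ a≢j t t′ tₐ≡t′ₐ with diagonal-rainbow p′ (c (box p t))
    ... | u , eu with u ≟ t a
    ... | yes u≡tₐ = trans (sym eu) (dep′ _ _ (trans u≡tₐ tₐ≡t′ₐ))
    ... | no u≢tₐ = ⊥-elim (proper (crossing-edge a≢j (u≢tₐ ∘ sym)) (begin
      c (box p (probe p zero a (t a)))     ≡⟨ dep (probe p zero a (t a)) t (probe-b {p} {zero} a≢j) ⟩
      c (box p t)                          ≡⟨ sym eu ⟩
      c (box p′ (const u))                 ≡⟨ dep′ _ (probe p′ (suc zero) a u)
                                                (sym (probe-b {p′} {suc zero} a≢j)) ⟩
      c (box p′ (probe p′ (suc zero) a u)) ∎))
      where open ≡-Reasoning

  adjacent-boxes-same-coordinate : ∀ {j p p′ a b} → SameExcept j p p′ → Adj G (p j) (p′ j) →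
    BoxDependsOnly a p → BoxDependsOnly b p′ → b ≡ a
  adjacent-boxes-same-coordinate {j} {a = a} {b} same edge dep dep′ with b ≟ j | a ≟ j
  ... | no b≢j  | _       = Step.same-coordinate same edge dep dep′ b≢j
  ... | yes b≡j | yes a≡j = trans b≡j (sym a≡j)
  ... | yes _   | no a≢j  =
    sym (Step.same-coordinate (λ l l≢j → sym (same l l≢j)) (Graph.sym G edge) dep′ dep a≢j)

  all-boxes-depend : ∀ {i p₀} → BoxDependsOnly i p₀ → ∀ p → BoxDependsOnly i p
  all-boxes-depend {i} dep₀ p = update-all (BoxDependsOnly i) boxDependsOnly-≗ p dep₀
    (λ j r → connected-coordinate (BoxDependsOnly i) boxDependsOnly-≗ j move connected r (p j))
    where
    move : ∀ {j} q x → Adj G (q j) x → BoxDependsOnly i q → BoxDependsOnly i (q [ j ]≔ x)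
    move {j} q x edge dep with box-depends-on-one-coordinate (q [ j ]≔ x)
    ... | b , dep′ = subst (λ a → BoxDependsOnly a (q [ j ]≔ x))
      (adjacent-boxes-same-coordinate ([]≔-sameExcept q j x) ([]≔-edge q j edge) dep dep′) dep′

  -- Moves off coordinate i keep the color, as the boxes on both sides depend only on i;
  -- connectivity then joins any two vertices agreeing at i.
  coloring-dependsOnly : ∀ {i p₀} → BoxDependsOnly i p₀ → DependsOnly i c
  coloring-dependsOnly {i} dep₀ v w vᵢ≡wᵢ =
    sym (proj₂ (update-all R R-resp {v} w (refl , refl) update))
    where
    R : V (Power G m) → Set
    R r = r i ≡ v i × c r ≡ c v

    R-resp : ∀ {p q} → p ≗ q → R p → R q
    R-resp p≗q (e₁ , e₂) = trans (sym (p≗q i)) e₁ , trans (sym (c-≗ p≗q)) e₂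

    move : ∀ {j} → j ≢ i → ∀ q x → Adj G (q j) x → R q → R (q [ j ]≔ x)
    move {j} j≢i q x edge (e₁ , e₂) = trans ([]≔-minimal q x i≢j) e₁ , (begin
      c q′                       ≡⟨ c-as-box q′ ⟩
      c (box q′ (position ∘ q′)) ≡⟨ sym boxes-agree ⟩
      c (box q (position ∘ q))   ≡⟨ sym (c-as-box q) ⟩
      c q                        ≡⟨ e₂ ⟩
      c v                        ∎)
      where
      open ≡-Reasoning
      q′ : Base
      q′ = q [ j ]≔ x

      i≢j : i ≢ j
      i≢j = j≢i ∘ sym

      boxes-agree : c (box q (position ∘ q)) ≡ c (box q′ (position ∘ q′))
      boxes-agree = Step.colors-agree ([]≔-sameExcept q j x) ([]≔-edge q j edge)
        (all-boxes-depend dep₀ q) (all-boxes-depend dep₀ q′) i≢j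
        _ _ (cong position (sym ([]≔-minimal q x i≢j)))

    update : ∀ j r → R r → R (r [ j ]≔ w j)
    update j r Rr@(rᵢ≡vᵢ , _) with j ≟ i
    ... | yes refl = R-resp (λ l → sym (updateAt-id-local j r (trans (sym vᵢ≡wᵢ) (sym rᵢ≡vᵢ)) l)) Rr
    ... | no j≢i = connected-coordinate R R-resp j (move j≢i) connected r (w j) Rr

  trivial : V G → IsTrivialPowerColoring G m (3 + k') c
  trivial v₀ with box-depends-on-one-coordinate (const v₀)
  ... | i , dep₀ = i , (λ x → c (const x)) , (λ edge → proper (const edge)) ,
                   (λ v → coloring-dependsOnly dep₀ v (const (v i)) refl)

power-coloring-trivial : ∀ {G k m} → Connected G → 3 ≤ k → CliqueCover G k → V G →
  ∀ c → IsColoring (Power G m) k c → IsTrivialPowerColoring G m k c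
power-coloring-trivial connected (s≤s (s≤s (s≤s _))) cover v₀ c proper =
  Boxes.trivial connected cover c proper v₀

power-chromatic : ∀ {G m k₀ k} → IsChromaticNumber G k₀ → IsChromaticNumber (Power G m) k → k₀ ≡ k
power-chromatic ((φ , φ-proper) , χ₀-min) ((c , c-proper) , χ-min) = ≤-antisym
  (≮⇒≥ λ k<k₀ → χ₀-min _ k<k₀ ((λ x → c (const x)) , λ edge → c-proper (const edge)))
  (≮⇒≥ λ k₀<k → χ-min _ k₀<k ((λ v → φ (v zero)) , λ edge → φ-proper (edge zero)))

vertex : ∀ {G} → Finite G → ¬ Colorable G 0 → V G
vertex (zero , V≅Fin0) not-0-colorable =
  ⊥-elim (not-0-colorable (Inverse.to V≅Fin0 , λ {u} _ _ → ¬Fin0 (Inverse.to V≅Fin0 u)))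
vertex (suc _ , V≅Fin) _ = Inverse.from V≅Fin zero

cliqueCover : ∀ {G k} →
  (∀ v → Σ (Fin k → V G) λ f → (∀ i j → i ≢ j → Adj G (f i) (f j)) × ∃ λ i → f i ≡ v) →
  CliqueCover G k
cliqueCover cliques = record
  { clique          = λ v → proj₁ (cliques v)
  ; clique-adj      = λ v a≢b → proj₁ (proj₂ (cliques v)) _ _ a≢b
  ; position        = λ v → proj₁ (proj₂ (proj₂ (cliques v)))
  ; clique-position = λ v → proj₂ (proj₂ (proj₂ (cliques v)))
  }

mainTheorem1 : (G : Graph) → Finite G → Connected G → WeaklyCliqued G →
    (∀ k → IsChromaticNumber G k → 3 ≤ k) →
    TriviallyPowerColorable G
mainTheorem1 G finite connected (k₀ , χ₀ , cliques) χ≥3 m k χ c proper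
  with refl ← power-chromatic {G} {m} χ₀ χ =
  power-coloring-trivial connected k≥3 (cliqueCover cliques) (vertex {G} finite not-0-colorable) c proper
  where
  k≥3 : 3 ≤ k₀
  k≥3 = χ≥3 k₀ χ₀
  not-0-colorable : ¬ Colorable G 0
  not-0-colorable = proj₂ χ₀ 0 (≤-trans (s≤s z≤n) k≥3)
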